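{- A set of edges $S$ in a plane triangulation $G\neq K_3$ is flippable if and only if: (1) no two edges in $S$ are consecutive; (2) no two edges in $S$ form a bad pair; and (3) for every edge $vw\in S$, either $vw$ is individually flippable or the edge that blocks $vw$ is also in $S$.
   Context: A (plane) triangulation is a simple planar graph with a fixed combinatorial plane embedding in which every face is bounded by a $3$-cycle. For an edge $vw$ with incident faces $(v,w,x)$ and $(w,v,y)$, the vertices $x,y$ see $vw$; flipping $vw$ means deleting $vw$ and adding the edge $xy$ embedded inside the quadrilateral formed by the two faces. $vw$ is individually flippable if the result is a triangulation (simple); otherwise (when $G\neq K_3$) $xy$ is already an edge of $G$, and $vw$ is said to be blocked by $xy$. For a set $S$ of edges, $\mathcal{F}(G,S)$ denotes the embedded graph obtained by flipping every edge of $S$; $S$ is flippable if $\mathcal{F}(G,S)$ is a triangulation. Two edges are consecutive if they are incident to a common face. Two edges form a bad pair if they are seen by the same pair of vertices. -}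

module Defs where

open import Data.Nat using (ℕ; _+_; _*_)
open import Data.Fin using (Fin; zero; suc; _≟_)
open import Data.Bool using (Bool; true; false; _∧_; _∨_)
open import Data.Product using (Σ; _×_; _,_; proj₁; proj₂)
open import Data.Sum using (_⊎_; inj₁; inj₂)
open import Relation.Nullary using (¬_)
open import Relation.Nullary.Decidable using (⌊_⌋)
open import Relation.Binary.PropositionalEquality using (_≡_; _≢_)
open import Relation.Binary.Construct.Closure.ReflexiveTransitive using (Star)
open import Function.Bundles using (_↔_)

-- A triangle (a , b , c)
-- is a face traversed a → b → c → a; faces are identified up to
-- cyclic rotation (never up to reflection: orientation matters).

Tri : ℕ → Set
Tri n = Fin n × Fin n × Fin n

corner : ∀ {n} → Tri n → Fin 3 → Fin n
corner (a , b , c) zero = a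
corner (a , b , c) (suc zero) = b
corner (a , b , c) (suc (suc zero)) = c

next3 : Fin 3 → Fin 3
next3 zero = suc zero
next3 (suc zero) = suc (suc zero)
next3 (suc (suc zero)) = zero

module FaceFamily {n : ℕ} {I : Set} (face : I → Tri n) where

  HasDart : Fin n → Fin n → Set
  HasDart u v = Σ I λ i → Σ (Fin 3) λ k →
    corner (face i) k ≡ u × corner (face i) (next3 k) ≡ v

  HasFace : Fin n → Fin n → Fin n → Set
  HasFace u v w = Σ I λ i → Σ (Fin 3) λ k →
    corner (face i) k ≡ u × corner (face i) (next3 k) ≡ v
      × corner (face i) (next3 (next3 k)) ≡ w

  -- A family of oriented triangles is a (simple, plane) triangulation
  -- on the vertex set Fin n iff:
  --  * every face has three distinct vertices (no loops);
  --  * each directed edge lies on at most one face (so every edge is on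
  --    exactly two faces, with opposite orientations, and there are no
  --    multiple edges);
  --  * edges are undirected (u → v occurs iff v → u occurs);
  --  * the graph is connected;
  --  * the link of every vertex is a single cycle (a closed surface);
  --  * Euler's formula for the sphere: V - E + F = 2, i.e. (since
  --    2E = 3F) F + 4 = 2V, where F is the number of faces.
  record IsTriangulation : Set where
    field
      distinct   : ∀ i → corner (face i) zero ≢ corner (face i) (suc zero)
                       × corner (face i) (suc zero) ≢ corner (face i) (suc (suc zero))
                       × corner (face i) (suc (suc zero)) ≢ corner (face i) zero
      dartUnique : ∀ i j k l → corner (face i) k ≡ corner (face j) l
                     → corner (face i) (next3 k) ≡ corner (face j) (next3 l) → i ≡ j
      dartSym    : ∀ u v → HasDart u v → HasDart v u
      connected  : ∀ u v → Star HasDart u v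
      linkCycle  : ∀ v a b → HasDart v a → HasDart v b → Star (HasFace v) a b
      euler      : Σ ℕ λ f → (I ↔ Fin f) × (f + 4 ≡ 2 * n)

record Triangulation : Set where
  field
    n     : ℕ
    f     : ℕ
    face  : Fin f → Tri n
    isTri : FaceFamily.IsTriangulation face

open Triangulation public

module _ (G : Triangulation) where
  open FaceFamily (face G)

  Edge : Fin (n G) → Fin (n G) → Set
  Edge = HasDart

  IsK3 : Set
  IsK3 = (n G ≡ 3) × (∀ u v → u ≢ v → Edge u v)

  Sees : (v w x y : Fin (n G)) → Set
  Sees v w x y = HasFace v w x × HasFace w v y

  EdgeSet : (Fin (n G) → Fin (n G) → Bool) → Set
  EdgeSet S = (∀ u v → S u v ≡ true → Edge u v) × (∀ u v → S u v ≡ S v u)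

  Dart : Set
  Dart = Fin (f G) × Fin 3

  tail head opp : Dart → Fin (n G)
  tail (i , k) = corner (face G i) k
  head (i , k) = corner (face G i) (next3 k)
  opp  (i , k) = corner (face G i) (next3 (next3 k))

  -- Faces of F(G,S):
  --  * every face of G none of whose edges is in S, and
  --  * for each dart d = (v → w) with vw ∈ S, lying on face (v , w , x),
  --    with twin dart e = (w → v) lying on face (w , v , y), the new face
  --    (x , v , y).  (So flipping vw replaces faces (v,w,x), (w,v,y)
  --    by (x,v,y), (y,w,x), which contain the new edge xy.)
  FlipIndex : (Fin (n G) → Fin (n G) → Bool) → Set
  FlipIndex S =
      (Σ (Fin (f G)) λ i →
          S (tail (i , zero)) (head (i , zero)) ≡ false
        × S (tail (i , suc zero)) (head (i , suc zero)) ≡ false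
        × S (tail (i , suc (suc zero))) (head (i , suc (suc zero))) ≡ false)
    ⊎ (Σ Dart λ d → Σ Dart λ e →
          S (tail d) (head d) ≡ true × tail e ≡ head d × head e ≡ tail d)

  flipFace : (S : Fin (n G) → Fin (n G) → Bool) → FlipIndex S → Tri (n G)
  flipFace S (inj₁ (i , _)) = face G i
  flipFace S (inj₂ (d , e , _)) = opp d , tail d , opp e

  Flippable : (Fin (n G) → Fin (n G) → Bool) → Set
  Flippable S = FaceFamily.IsTriangulation (flipFace S)

  single : Fin (n G) → Fin (n G) → Fin (n G) → Fin (n G) → Bool
  single v w a b = (⌊ a ≟ v ⌋ ∧ ⌊ b ≟ w ⌋) ∨ (⌊ a ≟ w ⌋ ∧ ⌊ b ≟ v ⌋)

  IndFlippable : Fin (n G) → Fin (n G) → Set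
  IndFlippable v w = Flippable (single v w)

  SamePair : (a b c d : Fin (n G)) → Set
  SamePair a b c d = (a ≡ c × b ≡ d) ⊎ (a ≡ d × b ≡ c)

  EdgeOfFace : Fin (f G) → Fin (n G) → Fin (n G) → Set
  EdgeOfFace i a b = Σ (Fin 3) λ k → SamePair (tail (i , k)) (head (i , k)) a b

  Consecutive : (a b c d : Fin (n G)) → Set
  Consecutive a b c d = Σ (Fin (f G)) λ i → EdgeOfFace i a b × EdgeOfFace i c d

  BadPair : (a b c d : Fin (n G)) → Set
  BadPair a b c d = Σ (Fin (n G)) λ x → Σ (Fin (n G)) λ y →
    Sees a b x y × (Sees c d x y ⊎ Sees c d y x)

  Cond1 Cond2 Cond3 : (Fin (n G) → Fin (n G) → Bool) → Set
  Cond1 S = ∀ a b c d → S a b ≡ true → S c d ≡ true → ¬ SamePair a b c d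
              → ¬ Consecutive a b c d
  Cond2 S = ∀ a b c d → S a b ≡ true → S c d ≡ true → ¬ SamePair a b c d
              → ¬ BadPair a b c d
  Cond3 S = ∀ v w → S v w ≡ true →
              IndFlippable v w ⊎ (Σ (Fin (n G)) λ x → Σ (Fin (n G)) λ y →
                                    Sees v w x y × Edge x y × S x y ≡ true)

{-# OPTIONS --safe #-}
-- F(G,S) keeps the faces of G with no edge in S and replaces the two faces (v,w,x), (w,v,y) on
-- each vw ∈ S by (x,v,y), (y,w,x).  Under (1), apart from the new edges xy, its darts are exactly
-- the darts of G not in S.  So F(G,S) is a triangulation once no face of G is flipped twice (1), no new
-- edge arises twice (2), no new edge is an unflipped edge of G (3), and x ≠ y, which holds as
-- G ≠ K₃; the link of a vertex in F(G,S) is its link in G with the flipped spokes skipped.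
-- Conversely, each violation of (1) or (2) makes F(G,S) repeat a dart; for (3), a blocker of vw
-- outside S is not an edge of G at all, so vw alone is flippable.
module Submission where

open import Defs hiding (Dart; tail; head; opp)
open import Data.Bool using (Bool; true; false; _∧_; _∨_)
open import Data.Bool.Properties as Bool using (not-¬)
open import Data.Fin using (Fin; zero; suc; _≟_)
open import Data.Fin.Properties using (cantor-schröder-bernstein)
open import Data.Product using (Σ; _×_; _,_; proj₁; proj₂)
open import Data.Sum using (_⊎_; inj₁; inj₂)
open import Data.Sum.Properties using (inj₂-injective)
open import Data.Empty using (⊥; ⊥-elim)
open import Function using (_∘_; id)
open import Relation.Nullary using (¬_; yes; no; Dec)
open import Relation.Nullary.Decidable using (⌊_⌋; _×-dec_; _⊎-dec_)
open import Relation.Binary.PropositionalEquality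
open import Relation.Binary.Construct.Closure.ReflexiveTransitive
  using (Star; ε; _◅_; _◅◅_; fold; _>>=_)
open import Function.Bundles using (_⇔_; _↔_; mk⇔; mk↔ₛ′)
open import Function.Properties.Inverse using (↔-trans)
open import Axiom.UniquenessOfIdentityProofs using (module Decidable⇒UIP)

pattern 𝟎 = zero
pattern 𝟏 = suc zero
pattern 𝟐 = suc (suc zero)

next3³≡id : ∀ k → next3 (next3 (next3 k)) ≡ k
next3³≡id 𝟎 = refl
next3³≡id 𝟏 = refl
next3³≡id 𝟐 = refl

next3k≢k : ∀ k → next3 k ≢ k
next3k≢k 𝟎 ()
next3k≢k 𝟏 ()
next3k≢k 𝟐 ()

next3²k≢k : ∀ k → next3 (next3 k) ≢ k
next3²k≢k 𝟎 ()
next3²k≢k 𝟏 ()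
next3²k≢k 𝟐 ()

next3-orbit : ∀ k l → l ≡ k ⊎ l ≡ next3 k ⊎ l ≡ next3 (next3 k)
next3-orbit 𝟎 𝟎 = inj₁ refl
next3-orbit 𝟎 𝟏 = inj₂ (inj₁ refl)
next3-orbit 𝟎 𝟐 = inj₂ (inj₂ refl)
next3-orbit 𝟏 𝟎 = inj₂ (inj₂ refl)
next3-orbit 𝟏 𝟏 = inj₁ refl
next3-orbit 𝟏 𝟐 = inj₂ (inj₁ refl)
next3-orbit 𝟐 𝟎 = inj₂ (inj₁ refl)
next3-orbit 𝟐 𝟏 = inj₂ (inj₂ refl)
next3-orbit 𝟐 𝟐 = inj₁ refl

DistinctCorners : ∀ {m} → Tri m → Set
DistinctCorners t = corner t 𝟎 ≢ corner t 𝟏 × corner t 𝟏 ≢ corner t 𝟐 × corner t 𝟐 ≢ corner t 𝟎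

corner-injective : ∀ {m} {t : Tri m} → DistinctCorners t → ∀ {k l} → corner t k ≡ corner t l → k ≡ l
corner-injective _               {𝟎} {𝟎} _  = refl
corner-injective (≢₀₁ , _ , _)   {𝟎} {𝟏} eq = ⊥-elim (≢₀₁ eq)
corner-injective (_ , _ , ≢₂₀)   {𝟎} {𝟐} eq = ⊥-elim (≢₂₀ (sym eq))
corner-injective (≢₀₁ , _ , _)   {𝟏} {𝟎} eq = ⊥-elim (≢₀₁ (sym eq))
corner-injective _               {𝟏} {𝟏} _  = refl
corner-injective (_ , ≢₁₂ , _)   {𝟏} {𝟐} eq = ⊥-elim (≢₁₂ eq)
corner-injective (_ , _ , ≢₂₀)   {𝟐} {𝟎} eq = ⊥-elim (≢₂₀ eq)
corner-injective (_ , ≢₁₂ , _)   {𝟐} {𝟏} eq = ⊥-elim (≢₁₂ (sym eq))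
corner-injective _               {𝟐} {𝟐} _  = refl

Bool-uip : {a b : Bool} (p q : a ≡ b) → p ≡ q
Bool-uip = Decidable⇒UIP.≡-irrelevant Bool._≟_

Fin-uip : ∀ {m} {a b : Fin m} (p q : a ≡ b) → p ≡ q
Fin-uip = Decidable⇒UIP.≡-irrelevant _≟_

module Properties (G : Triangulation) where
  open FaceFamily (face G)
  open FaceFamily.IsTriangulation (isTri G)

  V : Set
  V = Fin (n G)

  Dart : Set
  Dart = Defs.Dart G

  tail head opp : Dart → V
  tail = Defs.tail G
  head = Defs.head G
  opp  = Defs.opp G

  next prev : Dart → Dart
  next (i , k) = i , next3 k
  prev d = next (next d)

  Twin : Dart → Dart → Set
  Twin d e = tail e ≡ head d × head e ≡ tail d

  tail≢head : ∀ d → tail d ≢ head d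
  tail≢head (i , k) eq = next3k≢k k (sym (corner-injective (distinct i) eq))

  head≢opp : ∀ d → head d ≢ opp d
  head≢opp (i , k) eq = next3k≢k (next3 k) (sym (corner-injective (distinct i) eq))

  opp≢tail : ∀ d → opp d ≢ tail d
  opp≢tail (i , k) eq = next3²k≢k k (corner-injective (distinct i) eq)

  dart-unique : ∀ {d d'} → tail d ≡ tail d' → head d ≡ head d' → d ≡ d'
  dart-unique {i , k} {j , l} p q with dartUnique i j k l p q
  ... | refl = cong (i ,_) (corner-injective (distinct i) p)

  opp-next : ∀ d → opp (next d) ≡ tail d
  opp-next (i , k) = cong (corner (face G i)) (next3³≡id k)

  head-prev : ∀ d → head (prev d) ≡ tail d
  head-prev (i , k) = cong (corner (face G i)) (next3³≡id k)

  opp-prev : ∀ d → opp (prev d) ≡ head d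
  opp-prev (i , k) = cong (corner (face G i) ∘ next3) (next3³≡id k)

  next-prev : ∀ d → next (prev d) ≡ d
  next-prev (i , k) = cong (i ,_) (next3³≡id k)

  prev-injective : ∀ {d d'} → prev d ≡ prev d' → d ≡ d'
  prev-injective {d} {d'} eq = trans (sym (next-prev d)) (trans (cong next eq) (next-prev d'))

  next-injective : ∀ {d d'} → next d ≡ next d' → d ≡ d'
  next-injective {d} {d'} eq = trans (sym (next-prev d)) (trans (cong prev eq) (next-prev d'))

  twin-of : ∀ d → Σ Dart (Twin d)
  twin-of (i , k) with dartSym _ _ (i , k , refl , refl)
  ... | j , l , p , q = (j , l) , p , q

  twin : Dart → Dart
  twin d = proj₁ (twin-of d)

  isTwin : ∀ d → Twin d (twin d)
  isTwin d = proj₂ (twin-of d)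

  tail-twin : ∀ d → tail (twin d) ≡ head d
  tail-twin d = proj₁ (isTwin d)

  twin-sym : ∀ d e → Twin d e → Twin e d
  twin-sym _ _ (p , q) = sym q , sym p

  isTwin⁻¹ : ∀ d → Twin (twin d) d
  isTwin⁻¹ d = twin-sym d (twin d) (isTwin d)

  twin-unique : ∀ d e e' → Twin d e → Twin d e' → e ≡ e'
  twin-unique _ _ _ (p , q) (p' , q') = dart-unique (trans p (sym p')) (trans q (sym q'))

  hasDart : ∀ d → HasDart (tail d) (head d)
  hasDart (i , k) = i , k , refl , refl

  hasFace : ∀ d → HasFace (tail d) (head d) (opp d)
  hasFace (i , k) = i , k , refl , refl , refl

  hasFace⇒hasDart : ∀ {u v w} → HasFace u v w → HasDart u v
  hasFace⇒hasDart (i , k , p , q , _) = i , k , p , q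

  hasFace-rotate : ∀ {u v w} → HasFace u v w → HasFace v w u
  hasFace-rotate (i , k , p , q , r) = i , next3 k , q , r , trans (cong (corner (face G i)) (next3³≡id k)) p

  hasFace-unique : ∀ {u v w w'} → HasFace u v w → HasFace u v w' → w ≡ w'
  hasFace-unique (i , k , p , q , r) (j , l , p' , q' , r')
    with dart-unique {i , k} {j , l} (trans p (sym p')) (trans q (sym q'))
  ... | refl = trans (sym r) r'

  twin-hasFace : ∀ d e → Twin d e → HasFace (head d) (tail d) (opp e)
  twin-hasFace _ e (p , q) = subst₂ (λ a b → HasFace a b (opp e)) p q (hasFace e)

  neighbours-of-double-face : ∀ {p q r u} → HasFace p q r → HasFace q p r → HasDart p u → u ≡ q ⊎ u ≡ r
  neighbours-of-double-face {p} {q} {r} pqr qpr pu =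
    fold (λ a b → a ≡ q ⊎ a ≡ r → b ≡ q ⊎ b ≡ r) (λ step walk → walk ∘ turn step) id
         (linkCycle p q _ (hasFace⇒hasDart pqr) pu) (inj₁ refl)
    where
      turn : ∀ {a b} → HasFace p a b → a ≡ q ⊎ a ≡ r → b ≡ q ⊎ b ≡ r
      turn pab (inj₁ refl) = inj₂ (hasFace-unique pab pqr)
      turn pab (inj₂ refl) = inj₁ (hasFace-unique pab (hasFace-rotate qpr))

  -- If both faces on d have apex x, the neighbours of each corner of (tail d, head d, x) are the
  -- two other corners, so by connectedness G is this triangle.
  module CommonApex {d e : Dart} (tw : Twin d e) (same-apex : opp d ≡ opp e) where
    t : Tri (n G)
    t = tail d , head d , opp d

    c : Fin 3 → V
    c = corner t

    face-at : ∀ k → HasFace (c k) (c (next3 k)) (c (next3 (next3 k)))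
    face-at 𝟎 = hasFace d
    face-at 𝟏 = hasFace-rotate (hasFace d)
    face-at 𝟐 = hasFace-rotate (hasFace-rotate (hasFace d))

    reversed : HasFace (head d) (tail d) (opp d)
    reversed = subst (HasFace _ _) (sym same-apex) (twin-hasFace d e tw)

    reversed-face-at : ∀ k → HasFace (c (next3 k)) (c k) (c (next3 (next3 k)))
    reversed-face-at 𝟎 = reversed
    reversed-face-at 𝟏 = hasFace-rotate (hasFace-rotate reversed)
    reversed-face-at 𝟐 = hasFace-rotate reversed

    IsCorner : V → Set
    IsCorner u = Σ (Fin 3) λ k → c k ≡ u

    IsCorner-step : ∀ {a b} → HasDart a b → IsCorner a → IsCorner b
    IsCorner-step ab (k , refl) with neighbours-of-double-face (face-at k) (reversed-face-at k) ab
    ... | inj₁ eq = next3 k , sym eq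
    ... | inj₂ eq = next3 (next3 k) , sym eq

    every-vertex-is-corner : ∀ u → IsCorner u
    every-vertex-is-corner u =
      fold (λ a b → IsCorner a → IsCorner b) (λ step walk → walk ∘ IsCorner-step step) id
           (connected (tail d) u) (𝟎 , refl)

    corner-index : V → Fin 3
    corner-index = proj₁ ∘ every-vertex-is-corner

    corner-index-injective : ∀ {a b} → corner-index a ≡ corner-index b → a ≡ b
    corner-index-injective {a} {b} eq =
      trans (sym (proj₂ (every-vertex-is-corner a))) (trans (cong c eq) (proj₂ (every-vertex-is-corner b)))

    edge-between : ∀ k l → k ≢ l → HasDart (c k) (c l)
    edge-between k l k≢l with next3-orbit k l
    ... | inj₁ refl = ⊥-elim (k≢l refl)
    ... | inj₂ (inj₁ refl) = hasFace⇒hasDart (face-at k)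
    ... | inj₂ (inj₂ refl) = hasFace⇒hasDart (hasFace-rotate (reversed-face-at k))

    isK3 : IsK3 G
    isK3 = cantor-schröder-bernstein {f = corner-index} {g = c} corner-index-injective
             (corner-injective (tail≢head d , head≢opp d , opp≢tail d))
         , edges
      where
        edges : ∀ u v → u ≢ v → HasDart u v
        edges u v u≢v with every-vertex-is-corner u | every-vertex-is-corner v
        ... | k , refl | l , refl = edge-between k l (u≢v ∘ cong c)

  seers-distinct : ¬ IsK3 G → ∀ {d e} → Twin d e → opp d ≢ opp e
  seers-distinct notK3 {d} {e} tw same-apex = notK3 (CommonApex.isK3 {d} {e} tw same-apex)

  samePair-sym : ∀ {a b c d} → SamePair G a b c d → SamePair G c d a b
  samePair-sym (inj₁ (refl , refl)) = inj₁ (refl , refl)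
  samePair-sym (inj₂ (refl , refl)) = inj₂ (refl , refl)

  samePair-trans : ∀ {a b c d x y} → SamePair G a b c d → SamePair G c d x y → SamePair G a b x y
  samePair-trans (inj₁ (refl , refl)) cdxy                 = cdxy
  samePair-trans (inj₂ (refl , refl)) (inj₁ (refl , refl)) = inj₂ (refl , refl)
  samePair-trans (inj₂ (refl , refl)) (inj₂ (refl , refl)) = inj₁ (refl , refl)

  samePair? : ∀ a b c d → Dec (SamePair G a b c d)
  samePair? a b c d = ((a ≟ c) ×-dec (b ≟ d)) ⊎-dec ((a ≟ d) ×-dec (b ≟ c))

  module Singleton (d : Dart) where
    S₁ : V → V → Bool
    S₁ = single G (tail d) (head d)

    S₁-samePair : ∀ {a b} → S₁ a b ≡ true → SamePair G a b (tail d) (head d)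
    S₁-samePair {a} {b} ab∈ with a ≟ tail d | b ≟ head d | a ≟ head d | b ≟ tail d
    ... | yes p | yes q | _     | _     = inj₁ (p , q)
    ... | _     | _     | yes p | yes q = inj₂ (p , q)
    S₁-samePair () | no _  | _    | no _  | _
    S₁-samePair () | no _  | _    | yes _ | no _
    S₁-samePair () | yes _ | no _ | no _  | _
    S₁-samePair () | yes _ | no _ | yes _ | no _

    S₁-self : S₁ (tail d) (head d) ≡ true
    S₁-self with tail d ≟ tail d | head d ≟ head d
    ... | yes _    | yes _    = refl
    ... | no tail≢ | _        = ⊥-elim (tail≢ refl)
    ... | yes _    | no head≢ = ⊥-elim (head≢ refl)

    opp∉S₁ : ∀ {x} → S₁ (opp d) x ≢ true
    opp∉S₁ x∈ with S₁-samePair x∈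
    ... | inj₁ (eq , _) = opp≢tail d eq
    ... | inj₂ (eq , _) = head≢opp d (sym eq)

    edgeSet : EdgeSet G S₁
    edgeSet = S₁-edge , S₁-sym
      where
        S₁-edge : ∀ a b → S₁ a b ≡ true → HasDart a b
        S₁-edge a b ab∈ with S₁-samePair {a} {b} ab∈
        ... | inj₁ (refl , refl) = hasDart d
        ... | inj₂ (refl , refl) = dartSym _ _ (hasDart d)

        S₁-sym : ∀ a b → S₁ a b ≡ S₁ b a
        S₁-sym a b = trans (cong₂ _∨_ (Bool.∧-comm ⌊ a ≟ tail d ⌋ ⌊ b ≟ head d ⌋)
                                      (Bool.∧-comm ⌊ a ≟ head d ⌋ ⌊ b ≟ tail d ⌋))
                           (Bool.∨-comm (⌊ b ≟ head d ⌋ ∧ ⌊ a ≟ tail d ⌋)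
                                        (⌊ b ≟ tail d ⌋ ∧ ⌊ a ≟ head d ⌋))

    S₁-samePair₂ : ∀ {a b x y} → S₁ a b ≡ true → S₁ x y ≡ true → SamePair G a b x y
    S₁-samePair₂ ab∈ xy∈ = samePair-trans (S₁-samePair ab∈) (samePair-sym (S₁-samePair xy∈))

    cond1 : Cond1 G S₁
    cond1 _ _ _ _ ab∈ cd∈ different _ = different (S₁-samePair₂ ab∈ cd∈)

    cond2 : Cond2 G S₁
    cond2 _ _ _ _ ab∈ cd∈ different _ = different (S₁-samePair₂ ab∈ cd∈)

    twin-pair : ∀ g e → S₁ (tail g) (head g) ≡ true → Twin g e →
                (g ≡ d × e ≡ twin d) ⊎ (g ≡ twin d × e ≡ d)
    twin-pair g e g∈ tw with S₁-samePair g∈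
    ... | inj₁ (p , q) with dart-unique {g} {d} p q
    ...   | refl = inj₁ (refl , twin-unique d e (twin d) tw (isTwin d))
    twin-pair g e g∈ tw | inj₂ tw′ with twin-unique d (twin d) g (isTwin d) tw′
    ...   | refl = inj₂ (refl , twin-unique (twin d) e d tw (isTwin⁻¹ d))

  module Flip (S : V → V → Bool) (edgeSet : EdgeSet G S) where
    open FaceFamily (flipFace G S) public using () renaming (HasDart to FHasDart; HasFace to FHasFace)

    S-sym : ∀ u v → S u v ≡ S v u
    S-sym = proj₂ edgeSet

    inS : Dart → Bool
    inS d = S (tail d) (head d)

    inS-twin : ∀ d e → Twin d e → inS e ≡ inS d
    inS-twin d _ (p , q) = trans (cong₂ S p q) (S-sym (head d) (tail d))

    inS-samePair : ∀ g {a b} → SamePair G (tail g) (head g) a b → S a b ≡ true → inS g ≡ true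
    inS-samePair _ (inj₁ (refl , refl)) ab∈ = ab∈
    inS-samePair g (inj₂ (refl , refl)) ab∈ = trans (S-sym (tail g) (head g)) ab∈

    KeptEdge : V → V → Set
    KeptEdge u v = HasDart u v × S u v ≡ false

    keptEdge : ∀ g → inS g ≡ false → KeptEdge (tail g) (head g)
    keptEdge g g∉ = hasDart g , g∉

    keptEdge-sym : ∀ {u v} → KeptEdge u v → KeptEdge v u
    keptEdge-sym {u} {v} (uv , uv∉) = dartSym u v uv , trans (S-sym v u) uv∉

    Index : Set
    Index = FlipIndex G S

    fcorner : Index → Fin 3 → V
    fcorner I = corner (flipFace G S I)

    newFace : ∀ d → inS d ≡ true → Index
    newFace d d∈ = inj₂ (d , twin d , d∈ , isTwin d)

    newFaceOfTwin : ∀ d → inS d ≡ true → Index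
    newFaceOfTwin d d∈ = inj₂ (twin d , d , trans (inS-twin d (twin d) (isTwin d)) d∈ , isTwin⁻¹ d)

    newFace-≡ : ∀ {d e d∈ tw d' e' d'∈ tw'} → d ≡ d' → e ≡ e' →
             _≡_ {A = Index} (inj₂ (d , e , d∈ , tw)) (inj₂ (d' , e' , d'∈ , tw'))
    newFace-≡ {d∈ = d∈} {p , q} {d'∈ = d'∈} {p' , q'} refl refl
      rewrite Bool-uip d∈ d'∈ | Fin-uip p p' | Fin-uip q q' = refl

    newFace-injective : ∀ {d e d∈ tw d' e' d'∈ tw'} →
                     _≡_ {A = Index} (inj₂ (d , e , d∈ , tw)) (inj₂ (d' , e' , d'∈ , tw')) → d ≡ d'
    newFace-injective = cong proj₁ ∘ inj₂-injective

    Kept : Fin (f G) → Set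
    Kept i = inS (i , 𝟎) ≡ false × inS (i , 𝟏) ≡ false × inS (i , 𝟐) ≡ false

    kept-≡ : ∀ {i} {a b : Kept i} → _≡_ {A = Index} (inj₁ (i , a)) (inj₁ (i , b))
    kept-≡ {a = x , y , z} {x' , y' , z'} rewrite Bool-uip x x' | Bool-uip y y' | Bool-uip z z' = refl

    kept-notInS : ∀ {i} → Kept i → ∀ {g} → proj₁ g ≡ i → inS g ≡ false
    kept-notInS (x , _ , _) {_ , 𝟎} refl = x
    kept-notInS (_ , y , _) {_ , 𝟏} refl = y
    kept-notInS (_ , _ , z) {_ , 𝟐} refl = z

    kept-from : ∀ g → inS g ≡ false → inS (next g) ≡ false → inS (prev g) ≡ false → Kept (proj₁ g)
    kept-from (_ , 𝟎) x y z = x , y , z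
    kept-from (_ , 𝟏) x y z = z , x , y
    kept-from (_ , 𝟐) x y z = y , z , x

    IsNewEdge : Index → Fin 3 → Set
    IsNewEdge (inj₁ _) _ = ⊥
    IsNewEdge (inj₂ _) k = k ≡ 𝟐

    data EdgeKind : Index → Fin 3 → Set where
      old : ∀ {I k} → ¬ IsNewEdge I k → EdgeKind I k
      new : ∀ {d e d∈ tw} → EdgeKind (inj₂ (d , e , d∈ , tw)) 𝟐

    edgeKind : ∀ I k → EdgeKind I k
    edgeKind (inj₁ _) _ = old λ ()
    edgeKind (inj₂ _) 𝟎 = old λ ()
    edgeKind (inj₂ _) 𝟏 = old λ ()
    edgeKind (inj₂ _) 𝟐 = new

    OldDart : V → V → Set
    OldDart u v = Σ Index λ I → Σ (Fin 3) λ k →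
      fcorner I k ≡ u × fcorner I (next3 k) ≡ v × ¬ IsNewEdge I k

    oldDart⇒FHasDart : ∀ {u v} → OldDart u v → FHasDart u v
    oldDart⇒FHasDart (I , k , p , q , _) = I , k , p , q

    persist : ∀ g → inS g ≡ false → OldDart (tail g) (head g)
    persist g g∉ with inS (next g) in n∈ | inS (prev g) in p∈
    ... | true  | _     = newFace (next g) n∈ , 𝟎 , opp-next g , refl , λ ()
    ... | false | true  =
      newFaceOfTwin (prev g) p∈ , 𝟏 , trans (tail-twin (prev g)) (head-prev g) , opp-prev g , λ ()
    ... | false | false = inj₁ (proj₁ g , kept-from g g∉ n∈ p∈) , proj₂ g , refl , refl , λ ()

    underlying : ∀ I k → ¬ IsNewEdge I k → Dart
    underlying (inj₁ (i , _))     k _   = i , k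
    underlying (inj₂ (d , _))     𝟎 _   = prev d
    underlying (inj₂ (_ , e , _)) 𝟏 _   = next e
    underlying (inj₂ _)           𝟐 o = ⊥-elim (o refl)

    underlying-tail : ∀ I k o → tail (underlying I k o) ≡ fcorner I k
    underlying-tail (inj₁ _)                  _ _   = refl
    underlying-tail (inj₂ _)                  𝟎 _   = refl
    underlying-tail (inj₂ (_ , _ , _ , _ , q)) 𝟏 _  = q
    underlying-tail (inj₂ _)                  𝟐 o = ⊥-elim (o refl)

    underlying-head : ∀ I k o → head (underlying I k o) ≡ fcorner I (next3 k)
    underlying-head (inj₁ _)       _ _   = refl
    underlying-head (inj₂ (d , _)) 𝟎 _   = head-prev d
    underlying-head (inj₂ _)       𝟏 _   = refl
    underlying-head (inj₂ _)       𝟐 o = ⊥-elim (o refl)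

    new-reverse : ∀ d e → inS d ≡ true → Twin d e → FHasDart (opp d) (opp e)
    new-reverse d e d∈ tw = inj₂ (e , d , trans (inS-twin d e tw) d∈ , twin-sym d e tw) , 𝟐 , refl , refl

    edge-path : ∀ {u v} → HasDart u v → Star FHasDart u v
    edge-path (i , k , refl , refl) with inS (i , k) in g∈
    ... | false = oldDart⇒FHasDart (persist (i , k) g∈) ◅ ε
    ... | true  = (newFace (i , k) g∈ , 𝟏 , refl , refl)
                ◅ (newFaceOfTwin (i , k) g∈ , 𝟎 , refl , tail-twin (i , k)) ◅ ε

    link-step-unflipped : ∀ {v a b} → HasFace v a b → S v a ≡ false → S v b ≡ false → Star (FHasFace v) a b
    link-step-unflipped (i , k , refl , refl , refl) g∉ b∉ with inS (next (i , k)) in n∈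
    ... | false = (inj₁ (i , kept-from (i , k) g∉ n∈ p∉) , k , refl , refl , refl) ◅ ε
      where p∉ : inS (prev (i , k)) ≡ false
            p∉ = trans (cong (S _) (head-prev (i , k))) (trans (S-sym _ _) b∉)
    ... | true  = (newFace (next g) n∈ , 𝟎 , opp-next g , refl , refl)
                ◅ (newFaceOfTwin (next g) n∈ , 𝟐 , opp-next g , refl , tail-twin (next g)) ◅ ε
      where g = (i , k)

    link-step-flipped : ∀ {v a b c} → HasFace v a b → HasFace v b c → S v b ≡ true → FHasFace v a c
    link-step-flipped (i , k , refl , refl , refl) (j , l , p , q , refl) b∈ =
      inj₂ ((j , l) , prev (i , k) , trans (cong₂ S p q) b∈ , sym q , trans (head-prev (i , k)) (sym p))
      , 𝟏 , p , opp-prev (i , k) , refl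

    NoConsecutiveInS : Set
    NoConsecutiveInS = ∀ d → inS d ≡ true → inS (next d) ≡ false

    BlockersInS : Set
    BlockersInS = ∀ d e → inS d ≡ true → Twin d e → HasDart (opp d) (opp e) → S (opp d) (opp e) ≡ true

    SeersDistinct : Set
    SeersDistinct = ∀ d e → inS d ≡ true → Twin d e → opp d ≢ opp e

    noConsecutive-prev : NoConsecutiveInS → ∀ d → inS d ≡ true → inS (prev d) ≡ false
    noConsecutive-prev noCons d d∈ with inS (prev d) in p∈
    ... | false = refl
    ... | true  = ⊥-elim (not-¬ d∈ (subst (λ g → inS g ≡ false) (next-prev d) (noCons (prev d) p∈)))

    cond1⇒noConsecutive : Cond1 G S → NoConsecutiveInS
    cond1⇒noConsecutive cond1 d d∈ with inS (next d) in n∈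
    ... | false = refl
    ... | true  = ⊥-elim (cond1 _ _ _ _ d∈ n∈ different
                    (proj₁ d , (proj₂ d , inj₁ (refl , refl)) , (next3 (proj₂ d) , inj₁ (refl , refl))))
      where
        different : ¬ SamePair G (tail d) (head d) (tail (next d)) (head (next d))
        different (inj₁ (eq , _)) = tail≢head d eq
        different (inj₂ (eq , _)) = opp≢tail d (sym eq)

    noConsecutive⇒cond1 : NoConsecutiveInS → Cond1 G S
    noConsecutive⇒cond1 noCons _ _ _ _ ab∈ cd∈ different (i , (k , ab) , (l , cd)) with next3-orbit k l
    ... | inj₁ refl        = different (samePair-trans (samePair-sym ab) cd)
    ... | inj₂ (inj₁ refl) = not-¬ (inS-samePair (i , l) cd cd∈) (noCons (i , k) (inS-samePair (i , k) ab ab∈))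
    ... | inj₂ (inj₂ refl) = not-¬ (inS-samePair (i , k) ab ab∈)
            (subst (λ m → inS (i , m) ≡ false) (next3³≡id k) (noCons (i , l) (inS-samePair (i , l) cd cd∈)))

  module Sufficiency (S : V → V → Bool) (edgeSet : EdgeSet G S)
                     (noCons : Flip.NoConsecutiveInS S edgeSet) (cond2 : Cond2 G S)
                     (blockers : Flip.BlockersInS S edgeSet) (seers : Flip.SeersDistinct S edgeSet) where
    open Flip S edgeSet

    underlying-notInS : ∀ I k o → inS (underlying I k o) ≡ false
    underlying-notInS (inj₁ (i , kept))         k _ = kept-notInS kept {i , k} refl
    underlying-notInS (inj₂ (d , _ , d∈ , _))   𝟎 _ = noConsecutive-prev noCons d d∈
    underlying-notInS (inj₂ (d , e , d∈ , tw))  𝟏 _ = noCons e (trans (inS-twin d e tw) d∈)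
    underlying-notInS (inj₂ _)                  𝟐 o = ⊥-elim (o refl)

    kept-underlying-new : ∀ {i} → Kept i → ∀ J l o → proj₁ (underlying (inj₂ J) l o) ≢ i
    kept-underlying-new kept (d , _ , d∈ , _)  𝟎 _ eq = not-¬ d∈ (kept-notInS kept {d} eq)
    kept-underlying-new kept (d , e , d∈ , tw) 𝟏 _ eq = not-¬ (trans (inS-twin d e tw) d∈) (kept-notInS kept {e} eq)
    kept-underlying-new _    _                 𝟐 o = ⊥-elim (o refl)

    prev≢next : ∀ {d e} → inS d ≡ true → inS e ≡ true → prev d ≢ next e
    prev≢next {d} {e} d∈ e∈ eq =
      not-¬ d∈ (subst (λ g → inS g ≡ false) (sym d≡prev-e) (noConsecutive-prev noCons e e∈))
      where
        d≡prev-e : d ≡ prev e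
        d≡prev-e = trans (sym (next-prev d)) (cong next eq)

    underlying-injective : ∀ I J k l o o' → underlying I k o ≡ underlying J l o' → I ≡ J
    underlying-injective (inj₁ _) (inj₁ _) _ _ _ _ eq with cong proj₁ eq
    ... | refl = kept-≡
    underlying-injective (inj₁ (_ , kept)) (inj₂ J) _ l _ o' eq =
      ⊥-elim (kept-underlying-new kept J l o' (sym (cong proj₁ eq)))
    underlying-injective (inj₂ I) (inj₁ (_ , kept)) k _ o _ eq =
      ⊥-elim (kept-underlying-new kept I k o (cong proj₁ eq))
    underlying-injective (inj₂ (d , e , _ , tw)) (inj₂ (d' , e' , _ , tw')) 𝟎 𝟎 _ _ eq with prev-injective eq
    ... | refl = newFace-≡ refl (twin-unique d e e' tw tw')
    underlying-injective (inj₂ (d , e , _ , tw)) (inj₂ (d' , e' , _ , tw')) 𝟏 𝟏 _ _ eq with next-injective eq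
    ... | refl = newFace-≡ (twin-unique e d d' (twin-sym d e tw) (twin-sym d' e tw')) refl
    underlying-injective (inj₂ (_ , _ , d∈ , _)) (inj₂ (d' , e' , d'∈ , tw')) 𝟎 𝟏 _ _ eq =
      ⊥-elim (prev≢next d∈ (trans (inS-twin d' e' tw') d'∈) eq)
    underlying-injective (inj₂ (d , e , d∈ , tw)) (inj₂ (_ , _ , d'∈ , _)) 𝟏 𝟎 _ _ eq =
      ⊥-elim (prev≢next d'∈ (trans (inS-twin d e tw) d∈) (sym eq))
    underlying-injective (inj₂ _) (inj₂ _) 𝟐 _ o _ _ = ⊥-elim (o refl)
    underlying-injective (inj₂ _) (inj₂ _) _ 𝟐 _ o _ = ⊥-elim (o refl)

    old≢new : ∀ I k o d e → inS d ≡ true → Twin d e →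
              fcorner I k ≡ opp e → fcorner I (next3 k) ≡ opp d → ⊥
    old≢new I k o d e d∈ tw p q = not-¬ g∈ (underlying-notInS I k o)
      where
        g = underlying I k o
        g-tail : tail g ≡ opp e
        g-tail = trans (underlying-tail I k o) p
        g-head : head g ≡ opp d
        g-head = trans (underlying-head I k o) q
        g∈ : inS g ≡ true
        g∈ = trans (cong₂ S g-tail g-head)
                   (trans (S-sym (opp e) (opp d))
                          (blockers d e d∈ tw (dartSym _ _ (subst₂ HasDart g-tail g-head (hasDart g)))))

    new-unique : ∀ {d e d∈ tw d' e' d'∈ tw'} → opp e ≡ opp e' → opp d ≡ opp d' →
                 _≡_ {A = Index} (inj₂ (d , e , d∈ , tw)) (inj₂ (d' , e' , d'∈ , tw'))
    new-unique {d} {e} {d∈} {tw} {d'} {e'} {d'∈} {tw'} p q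
      with samePair? (tail d) (head d) (tail d') (head d')
    ... | no different = ⊥-elim (cond2 _ _ _ _ d∈ d'∈ different
            (opp d , opp e , (hasFace d , twin-hasFace d e tw)
            , inj₁ (subst (HasFace _ _) (sym q) (hasFace d') , subst (HasFace _ _) (sym p) (twin-hasFace d' e' tw'))))
    ... | yes (inj₁ (p′ , q′)) with dart-unique {d} {d'} p′ q′
    ...   | refl = newFace-≡ refl (twin-unique d e e' tw tw')
    new-unique {d} {e} {d∈} {tw} {d'} {e'} {d'∈} {tw'} p q | yes (inj₂ reversed) =
      ⊥-elim (seers d e d∈ tw (sym (trans p (cong opp (twin-unique d' e' d tw' reversed)))))

    flip-dartUnique : ∀ I J k l → fcorner I k ≡ fcorner J l → fcorner I (next3 k) ≡ fcorner J (next3 l) → I ≡ J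
    flip-dartUnique I J k l p q with edgeKind I k | edgeKind J l
    ... | old o | old o' = underlying-injective I J k l o o'
            (dart-unique (trans (underlying-tail I k o) (trans p (sym (underlying-tail J l o'))))
                         (trans (underlying-head I k o) (trans q (sym (underlying-head J l o')))))
    ... | old o | new {d} {e} {d∈} {tw} = ⊥-elim (old≢new I k o d e d∈ tw p q)
    ... | new {d} {e} {d∈} {tw} | old o = ⊥-elim (old≢new J l o d e d∈ tw (sym p) (sym q))
    ... | new | new = new-unique p q

    flip-distinct : ∀ I → DistinctCorners (flipFace G S I)
    flip-distinct (inj₁ (i , _)) = distinct i
    flip-distinct (inj₂ (d , e , d∈ , tw)) =
      opp≢tail d , (λ eq → head≢opp e (trans (proj₂ tw) eq)) , (λ eq → seers d e d∈ tw (sym eq))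

    underlying-reverse : ∀ I k o → OldDart (fcorner I (next3 k)) (fcorner I k)
    underlying-reverse I k o =
      subst₂ OldDart (trans (tail-twin g) (underlying-head I k o))
                     (trans (proj₂ (isTwin g)) (underlying-tail I k o))
             (persist (twin g) (trans (inS-twin g (twin g) (isTwin g)) (underlying-notInS I k o)))
      where g = underlying I k o

    flip-dartSym : ∀ u v → FHasDart u v → FHasDart v u
    flip-dartSym _ _ (I , k , refl , refl) with edgeKind I k
    ... | old o = oldDart⇒FHasDart (underlying-reverse I k o)
    ... | new {d} {e} {d∈} {tw} = new-reverse d e d∈ tw

    next-spoke-notInS : ∀ {v a b} → HasFace v a b → S v a ≡ true → S v b ≡ false
    next-spoke-notInS (i , k , refl , refl , refl) g∈ =
      trans (S-sym _ _) (trans (cong (S _) (sym (head-prev (i , k)))) (noConsecutive-prev noCons (i , k) g∈))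

    -- The two faces of G beside a flipped spoke vm merge into one face of F(G,S), and the spoke
    -- after vm is unflipped.
    lift-link-walk : ∀ {v a b} → S v a ≡ false → Star (HasFace v) a b → S v b ≡ false → Star (FHasFace v) a b
    lift-link-walk _ ε _ = ε
    lift-link-walk {v} a∉ (_◅_ {j = m} vam walk) b∉ with S v m in m∈
    ... | false = link-step-unflipped vam a∉ m∈ ◅◅ lift-link-walk m∈ walk b∉
    lift-link-walk a∉ (vam ◅ ε) b∉ | true = ⊥-elim (not-¬ m∈ b∉)
    lift-link-walk a∉ (vam ◅ vmc ◅ walk) b∉ | true =
      link-step-flipped vam vmc m∈ ◅ lift-link-walk (next-spoke-notInS vmc m∈) walk b∉

    old-keptEdge : ∀ I k o → KeptEdge (fcorner I k) (fcorner I (next3 k))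
    old-keptEdge I k o = subst₂ KeptEdge (underlying-tail I k o) (underlying-head I k o)
                                (keptEdge (underlying I k o) (underlying-notInS I k o))

    link-entry : ∀ {v a} → FHasDart v a → Σ V λ a' → KeptEdge v a' × Star (FHasFace v) a a'
    link-entry (I , k , refl , refl) with edgeKind I k
    ... | old o = _ , old-keptEdge I k o , ε
    ... | new {d} {e} {d∈} {tw} =
      tail d , subst (KeptEdge (opp e)) (proj₂ tw) (keptEdge-sym (keptEdge (next e) (noCons e e∈)))
             , (inj₂ (d , e , d∈ , tw) , 𝟐 , refl , refl , refl) ◅ ε
      where e∈ = trans (inS-twin d e tw) d∈

    link-exit : ∀ {v b} → FHasDart v b → Σ V λ b' → KeptEdge v b' × Star (FHasFace v) b' b
    link-exit (I , k , refl , refl) with edgeKind I k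
    ... | old o = _ , old-keptEdge I k o , ε
    ... | new {d} {e} {d∈} {tw} =
      tail e , subst (KeptEdge (opp e)) (head-prev e) (keptEdge (prev e) (noConsecutive-prev noCons e e∈))
             , (inj₂ (e , d , e∈ , twin-sym d e tw) , 𝟎 , refl , refl , refl) ◅ ε
      where e∈ = trans (inS-twin d e tw) d∈

    flip-linkCycle : ∀ v a b → FHasDart v a → FHasDart v b → Star (FHasFace v) a b
    flip-linkCycle v a b va vb with link-entry va | link-exit vb
    ... | a' , (va' , a'∉) , a→a' | b' , (vb' , b'∉) , b'→b =
      a→a' ◅◅ lift-link-walk a'∉ (linkCycle v a' b' va' vb') b'∉ ◅◅ b'→b

    faceOf : Index → Fin (f G)
    faceOf (inj₁ (i , _)) = i
    faceOf (inj₂ (d , _)) = proj₁ d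

    faceOf-injective : ∀ I J → faceOf I ≡ faceOf J → I ≡ J
    faceOf-injective (inj₁ _) (inj₁ _) refl = kept-≡
    faceOf-injective (inj₁ (_ , kept)) (inj₂ (d , _ , d∈ , _)) eq =
      ⊥-elim (not-¬ d∈ (kept-notInS kept {d} (sym eq)))
    faceOf-injective (inj₂ (d , _ , d∈ , _)) (inj₁ (_ , kept)) eq =
      ⊥-elim (not-¬ d∈ (kept-notInS kept {d} eq))
    faceOf-injective (inj₂ ((i , k) , e , d∈ , tw)) (inj₂ ((_ , l) , e' , d'∈ , tw')) refl with next3-orbit k l
    ... | inj₁ refl        = newFace-≡ refl (twin-unique (i , k) e e' tw tw')
    ... | inj₂ (inj₁ refl) = ⊥-elim (not-¬ d'∈ (noCons (i , k) d∈))
    ... | inj₂ (inj₂ refl) = ⊥-elim (not-¬ d'∈ (noConsecutive-prev noCons (i , k) d∈))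

    index-of-face : ∀ i → Σ Index λ I → faceOf I ≡ i
    index-of-face i with inS (i , 𝟎) in x | inS (i , 𝟏) in y | inS (i , 𝟐) in z
    ... | true  | _     | _     = newFace (i , 𝟎) x , refl
    ... | false | true  | _     = newFace (i , 𝟏) y , refl
    ... | false | false | true  = newFace (i , 𝟐) z , refl
    ... | false | false | false = inj₁ (i , x , y , z) , refl

    index↔face : Index ↔ Fin (f G)
    index↔face = mk↔ₛ′ faceOf (proj₁ ∘ index-of-face) (proj₂ ∘ index-of-face)
                       (λ I → faceOf-injective _ _ (proj₂ (index-of-face (faceOf I))))

    flippable : Flippable G S
    flippable = record
      { distinct   = flip-distinct
      ; dartUnique = flip-dartUnique
      ; dartSym    = flip-dartSym
      ; connected  = λ u v → connected u v >>= edge-path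
      ; linkCycle  = flip-linkCycle
      ; euler      = let (faces , faces↔ , count) = euler in faces , ↔-trans index↔face faces↔ , count
      }

  module Necessity (S : V → V → Bool) (edgeSet : EdgeSet G S) (flippable : Flippable G S) where
    open Flip S edgeSet
    module F = FaceFamily.IsTriangulation flippable

    -- Otherwise the dart opp d → tail d lies on the new faces of both d and twin (next d).
    noConsecutive : NoConsecutiveInS
    noConsecutive d d∈ with inS (next d) in n∈
    ... | false = refl
    ... | true  = ⊥-elim (opp≢tail d (sym (trans (cong tail d≡twin) (tail-twin (next d)))))
      where
        d≡twin : d ≡ twin (next d)
        d≡twin = newFace-injective (F.dartUnique (newFace d d∈) (newFaceOfTwin (next d) n∈) 𝟎 𝟏
                                                 (sym (tail-twin (next d))) (sym (opp-next d)))

    cond1 : Cond1 G S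
    cond1 = noConsecutive⇒cond1 noConsecutive

    cond2 : Cond2 G S
    cond2 _ _ _ _ ab∈ cd∈ different
          (_ , _ , ((i , k , refl , refl , refl) , (j , l , p , q , refl))
               , inj₁ ((i' , k' , refl , refl , x) , (j' , l' , p' , q' , y))) =
      different (inj₁ (cong tail same , cong head same))
      where
        same : (i , k) ≡ (i' , k')
        same = newFace-injective (F.dartUnique (inj₂ ((i , k) , (j , l) , ab∈ , p , q))
                                               (inj₂ ((i' , k') , (j' , l') , cd∈ , p' , q'))
                                               𝟐 𝟐 (sym y) (sym x))
    cond2 _ _ _ _ ab∈ cd∈ different
          (_ , _ , ((i , k , refl , refl , refl) , (j , l , p , q , refl))
               , inj₂ ((j' , l' , p' , q' , y) , (i' , k' , refl , refl , x))) =
      different (inj₂ (cong tail same , cong head same))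
      where
        same : (i , k) ≡ (i' , k')
        same = newFace-injective (F.dartUnique (inj₂ ((i , k) , (j , l) , ab∈ , p , q))
                                               (inj₂ ((i' , k') , (j' , l') , trans (S-sym _ _) cd∈ , p' , q'))
                                               𝟐 𝟐 (sym y) (sym x))

    new-edge-not-old : ∀ d e d∈ tw → ¬ OldDart (opp e) (opp d)
    new-edge-not-old d e d∈ tw (J , l , p , q , o) with F.dartUnique J (inj₂ (d , e , d∈ , tw)) l 𝟐 p q
    ... | refl = o (corner-injective (F.distinct J) p)

    blockers : BlockersInS
    blockers d e d∈ tw de with S (opp d) (opp e) in de∈
    ... | true  = refl
    ... | false with dartSym _ _ de
    ...   | i , k , p , q = ⊥-elim (new-edge-not-old d e d∈ tw (subst₂ OldDart p q (persist (i , k) ed∉)))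
      where ed∉ = trans (cong₂ S p q) (trans (S-sym (opp e) (opp d)) de∈)

    blocked-or-flippable : ∀ d → inS d ≡ true →
      IndFlippable G (tail d) (head d) ⊎
      (Σ V λ x → Σ V λ y → Sees G (tail d) (head d) x y × HasDart x y × S x y ≡ true)
    blocked-or-flippable d d∈ with S (opp d) (opp (twin d)) in blocker∈
    ... | true  = inj₂ (opp d , opp (twin d) , (hasFace d , twin-hasFace d (twin d) (isTwin d))
                       , proj₁ edgeSet _ _ blocker∈ , blocker∈)
    ... | false =
      inj₁ (Sufficiency.flippable S₁ edgeSet₁ (Flip₁.cond1⇒noConsecutive cond1₁) cond2₁ blockers₁ seers₁)
      where
        open Singleton d renaming (edgeSet to edgeSet₁; cond1 to cond1₁; cond2 to cond2₁)
        module Flip₁ = Flip S₁ edgeSet₁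

        blocker-in-S : HasDart (opp d) (opp (twin d)) → S (opp d) (opp (twin d)) ≡ true
        blocker-in-S = blockers d (twin d) d∈ (isTwin d)

        blockers₁ : Flip₁.BlockersInS
        blockers₁ d' e' d'∈ tw' d'e' with twin-pair d' e' d'∈ tw'
        ... | inj₁ (refl , refl) = ⊥-elim (not-¬ (blocker-in-S d'e') blocker∈)
        ... | inj₂ (refl , refl) = ⊥-elim (not-¬ (blocker-in-S (dartSym _ _ d'e')) blocker∈)

        seers₁ : Flip₁.SeersDistinct
        seers₁ d' e' d'∈ tw' with twin-pair d' e' d'∈ tw'
        ... | inj₁ (refl , refl) = λ eq → proj₂ (proj₂ (F.distinct (newFace d d∈))) (sym eq)
        ... | inj₂ (refl , refl) = proj₂ (proj₂ (F.distinct (newFace d d∈)))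

    cond3 : Cond3 G S
    cond3 v w vw∈ with proj₁ edgeSet v w vw∈
    ... | i , k , refl , refl = blocked-or-flippable (i , k) vw∈

  -- Applied to {vw}, Necessity.blockers shows that an individually flippable vw has no blocker.
  cond3⇒blockersInS : ∀ S (edgeSet : EdgeSet G S) → Cond3 G S → Flip.BlockersInS S edgeSet
  cond3⇒blockersInS S edgeSet cond3 d e d∈ tw de with cond3 (tail d) (head d) d∈
  ... | inj₁ indFlippable =
        ⊥-elim (opp∉S₁ (Necessity.blockers S₁ edgeSet₁ indFlippable d e S₁-self tw de))
    where open Singleton d renaming (edgeSet to edgeSet₁)
  ... | inj₂ (_ , _ , (dx , ey) , _ , xy∈) =
        subst₂ (λ a b → S a b ≡ true) (hasFace-unique dx (hasFace d))
                                      (hasFace-unique ey (twin-hasFace d e tw)) xy∈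

mainTheorem15 : (G : Triangulation) → ¬ IsK3 G
    → (S : Fin (n G) → Fin (n G) → Bool) → EdgeSet G S
    → Flippable G S ⇔ (Cond1 G S × Cond2 G S × Cond3 G S)
mainTheorem15 G notK3 S edgeSet = mk⇔
  (λ flippable → let open Necessity S edgeSet flippable in cond1 , cond2 , cond3)
  (λ (cond1 , cond2 , cond3) →
     Sufficiency.flippable S edgeSet (cond1⇒noConsecutive cond1) cond2 (cond3⇒blockersInS S edgeSet cond3)
                           (λ d e _ tw → seers-distinct notK3 {d} {e} tw))
  where
    open Properties G
    open Flip S edgeSet
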